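{- Let $A,s$ be positive integers and $(\alpha,\beta)\in(\mathbb{Z}/s\mathbb{Z})^2$. Let $S_{A,\alpha,\beta,s}$ be the set of binary $\mathbb{Z}$-lattices $[A,b,a]$ with $(a,b)\equiv(\alpha,\beta)\pmod s$ and $Aa-b^2>0$. Let $K,L$ be $\mathbb{Z}$-lattices on the same quadratic space $V$ with $K\prec_{A,(\alpha,\beta),s}L$, and let $\ell\in S_{A,\alpha,\beta,s}$. Then if $\ell$ is represented by $K$, it is represented by $L$. In particular, if $M\prec_{A,(\alpha,\beta),s}L$ for every $M\in\mathrm{gen}(L)$, then $\ell$ being represented by some lattice in $\mathrm{gen}(L)$ implies $\ell$ is represented by $L$.
   Context: All $\mathbb{Z}$-lattices are positive definite and integral, with bilinear form $B$ and quadratic map $Q(v)=B(v,v)$. $[A,b,a]$ denotes the binary lattice $\mathbb{Z}v_1+\mathbb{Z}v_2$ with $Q(v_1)=A$, $B(v_1,v_2)=b$, $Q(v_2)=a$. A representation $\ell\to L$ is a linear map preserving $B$. $\mathrm{gen}(L)$ is the set of lattices $K$ on $\mathbb{Q}L$ with $K_p\cong L_p$ for all primes $p$. $O(V)$ is the orthogonal group of $V$. For a lattice $K$ on $V$, $R(A,K)=\{v\in K: Q(v)=A\}$. For $v\in R(A,K)$: $R_v(K,\alpha,\beta,s)=\{u\in K/sK: Q(u)\equiv\alpha,\ B(u,v)\equiv\beta \pmod s\}$ and $R_v(K,L,s)=\{\tau\in O(V):\tau(sK)\subset L,\ \tau(v)\in L\}$. A coset $u\in R_v(K,\alpha,\beta,s)$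 is good (with respect to $L$) if there is $\tau\in R_v(K,L,s)$ with $\tau(\tilde u)\in L$ for all $\tilde u\in K$, $\tilde u\equiv u \pmod{sK}$; the set of good cosets is $R^L_v(K,\alpha,\beta,s)$. One writes $K\prec_{A,(\alpha,\beta),s}L$ if $R_v(K,\alpha,\beta,s)=R^L_v(K,\alpha,\beta,s)$ for every $v\in R(A,K)$. -}

module Defs where

open import Data.Nat as ℕ using (ℕ; zero; suc)
open import Data.Integer as ℤ using (ℤ; +_)
open import Data.Integer.Divisibility as ℤd using ()
open import Data.Rational as ℚ using (ℚ; _+_; _*_; _-_; 0ℚ; 1ℚ; _/_)
open import Data.Fin using (Fin; zero; suc)
open import Data.Product using (Σ; ∃; _×_; _,_)
open import Relation.Binary.PropositionalEquality using (_≡_; _≢_)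
open import Relation.Nullary using (¬_)
open import Data.Nat.Primality using (Prime)

ι : ℤ → ℚ
ι z = z / 1

Vect : ℕ → Set
Vect n = Fin n → ℚ

Σᶠ : ∀ {n} → (Fin n → ℚ) → ℚ
Σᶠ {zero}  f = 0ℚ
Σᶠ {suc n} f = f zero + Σᶠ (λ i → f (suc i))

Σᶻ : ∀ {n} → (Fin n → ℤ) → ℤ
Σᶻ {zero}  f = + 0
Σᶻ {suc n} f = f zero ℤ.+ Σᶻ (λ i → f (suc i))

_⊕_ : ∀ {n} → Vect n → Vect n → Vect n
(x ⊕ y) i = x i + y i

_·_ : ∀ {n} → ℚ → Vect n → Vect n
(c · x) i = c * x i

_≡_[modℚ_] : ℚ → ℚ → ℤ → Set
x ≡ y [modℚ N ] = ∃ λ (m : ℤ) → x ≡ y + ι N * ι m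

bil : ∀ {n} → (Fin n → Fin n → ℚ) → Vect n → Vect n → ℚ
bil G x y = Σᶠ (λ i → Σᶠ (λ j → x i * G i j * y j))

record QuadSpace (n : ℕ) : Set where
  field
    gram   : Fin n → Fin n → ℚ
    symm   : ∀ i j → gram i j ≡ gram j i
    posdef : ∀ (x : Vect n) → ¬ (∀ i → x i ≡ 0ℚ) → 0ℚ ℚ.< bil gram x x

δ : ∀ {n} → Fin n → Fin n → ℚ
δ zero    zero    = 1ℚ
δ zero    (suc _) = 0ℚ
δ (suc _) zero    = 0ℚ
δ (suc i) (suc j) = δ i j

module _ {n : ℕ} (V : QuadSpace n) where
  open QuadSpace V

  B : Vect n → Vect n → ℚ
  B = bil gram

  Q : Vect n → ℚ
  Q v = B v v

  record Lattice : Set where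
    field
      basis    : Fin n → Vect n
      indep    : ∀ (c : Fin n → ℚ) →
                   (∀ k → Σᶠ (λ i → c i * basis i k) ≡ 0ℚ) → ∀ i → c i ≡ 0ℚ
      integral : ∀ i j → ∃ λ (z : ℤ) → B (basis i) (basis j) ≡ ι z

  _∈_ : Vect n → Lattice → Set
  v ∈ K = ∃ λ (c : Fin n → ℤ) →
            ∀ k → v k ≡ Σᶠ (λ i → ι (c i) * Lattice.basis K i k)

  gramL : Lattice → Fin n → Fin n → ℚ
  gramL K i j = B (Lattice.basis K i) (Lattice.basis K j)

  Mat : Set
  Mat = Fin n → Fin n → ℚ

  app : Mat → Vect n → Vect n
  app M x i = Σᶠ (λ j → M i j * x j)

  InO : Mat → Set
  InO M = (∀ x y → B (app M x) (app M y) ≡ B x y)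
        × (∃ λ (N : Mat) → (∀ x i → app N (app M x) i ≡ x i)
                         × (∀ x i → app M (app N x) i ≡ x i))

  RvKLs : Vect n → Lattice → Lattice → ℕ → Mat → Set
  RvKLs v K L s τ = InO τ
                  × (∀ w → w ∈ K → app τ (ι (+ s) · w) ∈ L)
                  × (app τ v ∈ L)

  CongMod : Lattice → ℕ → Vect n → Vect n → Set
  CongMod K s ũ u = ∃ λ w → w ∈ K × (∀ i → ũ i ≡ (u ⊕ (ι (+ s) · w)) i)

  Good : Vect n → Lattice → Lattice → ℕ → Vect n → Set
  Good v K L s u = ∃ λ (τ : Mat) → RvKLs v K L s τ
                 × (∀ ũ → ũ ∈ K → CongMod K s ũ u → app τ ũ ∈ L)

  -- K ≺_{A,(α,β),s} L : for every v ∈ R(A,K), every coset in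
  -- R_v(K,α,β,s) (represented by u ∈ K) is good, i.e. R_v = R^L_v
  Prec : ℕ → ℤ → ℤ → ℕ → Lattice → Lattice → Set
  Prec A α β s K L =
    ∀ v → v ∈ K → Q v ≡ ι (+ A) →
    ∀ u → u ∈ K → Q u ≡ ι α [modℚ + s ] → B u v ≡ ι β [modℚ + s ] →
    Good v K L s u

  Represents : Lattice → ℤ → ℤ → ℤ → Set
  Represents K A b a = ∃ λ x → ∃ λ y → x ∈ K × y ∈ K
                     × Q x ≡ ι A × B x y ≡ ι b × Q y ≡ ι a

  -- Genus.  K_p ≅ L_p is encoded as: for every k there is an integral
  -- matrix T, invertible mod p, with Tᵗ G_L T ≡ G_K (mod p^k)
  -- (equivalent to ℤ_p-isometry by compactness of GL_n(ℤ_p)).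

  LocIso : ℕ → Lattice → Lattice → Set
  LocIso p K L = ∀ (k : ℕ) → ∃ λ (T : Fin n → Fin n → ℤ) →
      (∃ λ (U : Fin n → Fin n → ℤ) → ∀ i j →
          ι (Σᶻ (λ m → T i m ℤ.* U m j)) ≡ δ i j [modℚ + p ])
    × (∀ i j → Σᶠ (λ a → Σᶠ (λ b → ι (T a i) * gramL L a b * ι (T b j)))
                 ≡ gramL K i j [modℚ + (p ℕ.^ k) ])

  InGenus : Lattice → Lattice → Set
  InGenus M L = ∀ p → Prime p → LocIso p M L

InS : ℕ → ℤ → ℤ → ℕ → ℤ → ℤ → Set
InS A α β s b a = ((+ s) ℤd.∣ (a ℤ.- α)) × ((+ s) ℤd.∣ (b ℤ.- β))
                × (+ 0 ℤ.< (+ A) ℤ.* a ℤ.- b ℤ.* b)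

{-# OPTIONS --safe #-}
module Submission where

-- Let x, y ∈ K realise [A,b,a]. Then Q y ≡ a ≡ α and B(y,x) ≡ b ≡ β (mod s), so
-- y + sK lies in R_x(K,α,β,s), and K ≺ L makes this coset good: an isometry τ
-- with τx ∈ L maps y + sK, in particular y, into L. Hence τx, τy realise
-- [A,b,a] in L. The genus statement is the case K = M.

open import Defs
open import Data.Nat using (ℕ; _>_; zero; suc)
open import Data.Integer using (ℤ; +_)
open import Data.Product using (∃; _×_; _,_)
open import Data.Fin using (Fin; zero; suc)
import Data.Integer as ℤ
import Data.Integer.Divisibility as ℤd
import Data.Integer.Divisibility.Signed as ℤs
import Data.Integer.Properties as ℤP
open import Data.Integer.Tactic.RingSolver using (solve-∀)
open import Data.Rational using (ℚ; _+_; _*_; 0ℚ; toℚᵘ)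
import Data.Rational.Properties as ℚP
open import Data.Rational.Solver using (module +-*-Solver)
open import Data.Rational.Unnormalised as ℚᵘ using (mkℚᵘ; *≡*) renaming (_≃_ to _≃ᵘ_)
import Data.Rational.Unnormalised.Properties as ℚᵘP
open import Algebra.Properties.CommutativeMonoid.Sum ℚP.+-0-commutativeMonoid
  using (sum; sum-replicate-zero; ∑-comm)
open import Relation.Binary.PropositionalEquality

Σᶠ-cong : ∀ {n} {f g : Fin n → ℚ} → (∀ i → f i ≡ g i) → Σᶠ f ≡ Σᶠ g
Σᶠ-cong {zero}  f≗g = refl
Σᶠ-cong {suc n} f≗g = cong₂ _+_ (f≗g zero) (Σᶠ-cong (λ i → f≗g (suc i)))

Σᶠ≡sum : ∀ {n} (f : Fin n → ℚ) → Σᶠ f ≡ sum f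
Σᶠ≡sum {zero}  f = refl
Σᶠ≡sum {suc n} f = cong (_+_ (f zero)) (Σᶠ≡sum (λ i → f (suc i)))

Σᶠ-zero : ∀ n → Σᶠ {n} (λ _ → 0ℚ) ≡ 0ℚ
Σᶠ-zero n = trans (Σᶠ≡sum {n} (λ _ → 0ℚ)) (sum-replicate-zero n)

Σᶠ-comm : ∀ {m n} (f : Fin m → Fin n → ℚ) →
          Σᶠ (λ i → Σᶠ (λ j → f i j)) ≡ Σᶠ (λ j → Σᶠ (λ i → f i j))
Σᶠ-comm f = begin
  Σᶠ (λ i → Σᶠ (λ j → f i j))  ≡⟨ Σᶠ²≡sum² f ⟩
  sum (λ i → sum (λ j → f i j)) ≡⟨ ∑-comm f ⟩
  sum (λ j → sum (λ i → f i j)) ≡⟨ Σᶠ²≡sum² (λ j i → f i j) ⟨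
  Σᶠ (λ j → Σᶠ (λ i → f i j))  ∎
  where
  open ≡-Reasoning
  Σᶠ²≡sum² : ∀ {m n} (g : Fin m → Fin n → ℚ) →
             Σᶠ (λ i → Σᶠ (λ j → g i j)) ≡ sum (λ i → sum (λ j → g i j))
  Σᶠ²≡sum² {m} g = trans (Σᶠ-cong (λ i → Σᶠ≡sum (g i))) (Σᶠ≡sum {m} _)

bil-sym : ∀ {n} (G : Fin n → Fin n → ℚ) → (∀ i j → G i j ≡ G j i) →
          ∀ x y → bil G y x ≡ bil G x y
bil-sym G G-sym x y = trans (Σᶠ-comm (λ i j → y i * G i j * x j))
                            (Σᶠ-cong (λ j → Σᶠ-cong (λ i → swap j i)))
  where
  open +-*-Solver
  swap : ∀ j i → y i * G i j * x j ≡ x j * G j i * y i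
  swap j i = trans (cong (λ g → y i * g * x j) (G-sym i j))
                   (solve 3 (λ a g b → a :* g :* b := b :* g :* a) refl (y i) (G j i) (x j))

toℚᵘ-ι : ∀ z → toℚᵘ (ι z) ≃ᵘ mkℚᵘ z 0
toℚᵘ-ι z = ℚP.toℚᵘ-fromℚᵘ (mkℚᵘ z 0)

ι-homo-+ : ∀ x y → ι (x ℤ.+ y) ≡ ι x + ι y
ι-homo-+ x y = ℚP.toℚᵘ-injective (begin
  toℚᵘ (ι (x ℤ.+ y))            ≈⟨ toℚᵘ-ι (x ℤ.+ y) ⟩
  mkℚᵘ (x ℤ.+ y) 0              ≈⟨ *≡* (cross-multiplied x y) ⟩
  mkℚᵘ x 0 ℚᵘ.+ mkℚᵘ y 0        ≈⟨ ℚᵘP.+-cong (toℚᵘ-ι x) (toℚᵘ-ι y) ⟨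
  toℚᵘ (ι x) ℚᵘ.+ toℚᵘ (ι y)    ≈⟨ ℚP.toℚᵘ-homo-+ (ι x) (ι y) ⟨
  toℚᵘ (ι x + ι y)              ∎)
  where
  open ℚᵘP.≃-Reasoning
  cross-multiplied : ∀ x y → (x ℤ.+ y) ℤ.* + 1 ≡ (x ℤ.* + 1 ℤ.+ y ℤ.* + 1) ℤ.* + 1
  cross-multiplied = solve-∀

ι-homo-* : ∀ x y → ι (x ℤ.* y) ≡ ι x * ι y
ι-homo-* x y = ℚP.toℚᵘ-injective (begin
  toℚᵘ (ι (x ℤ.* y))            ≈⟨ toℚᵘ-ι (x ℤ.* y) ⟩
  mkℚᵘ (x ℤ.* y) 0              ≡⟨⟩
  mkℚᵘ x 0 ℚᵘ.* mkℚᵘ y 0        ≈⟨ ℚᵘP.*-cong (toℚᵘ-ι x) (toℚᵘ-ι y) ⟨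
  toℚᵘ (ι x) ℚᵘ.* toℚᵘ (ι y)    ≈⟨ ℚP.toℚᵘ-homo-* (ι x) (ι y) ⟨
  toℚᵘ (ι x * ι y)              ∎)
  where open ℚᵘP.≃-Reasoning

∣⇒≡[modℚ] : ∀ {q} N a α → N ℤd.∣ (a ℤ.- α) → q ≡ ι a → q ≡ ι α [modℚ N ]
∣⇒≡[modℚ] {q} N a α N∣a-α q≡a with ℤs.∣ᵤ⇒∣ N∣a-α
... | ℤs.divides k a-α≡kN = k , (begin
  q                        ≡⟨ q≡a ⟩
  ι a                      ≡⟨ cong ι (a≡α+[a-α] a α) ⟩
  ι (α ℤ.+ (a ℤ.- α))      ≡⟨ cong (λ d → ι (α ℤ.+ d)) (trans a-α≡kN (ℤP.*-comm k N)) ⟩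
  ι (α ℤ.+ N ℤ.* k)        ≡⟨ ι-homo-+ α (N ℤ.* k) ⟩
  ι α + ι (N ℤ.* k)        ≡⟨ cong (_+_ (ι α)) (ι-homo-* N k) ⟩
  ι α + ι N * ι k          ∎)
  where
  open ≡-Reasoning
  a≡α+[a-α] : ∀ a α → a ≡ α ℤ.+ (a ℤ.- α)
  a≡α+[a-α] = solve-∀

module _ {n} (V : QuadSpace n) where

  0∈ : (K : Lattice V) → _∈_ V (λ _ → 0ℚ) K
  0∈ K = (λ _ → + 0) , λ k → sym (trans (Σᶠ-cong (λ i → ℚP.*-zeroˡ (Lattice.basis K i k)))
                                         (Σᶠ-zero n))

  CongMod-refl : ∀ K s u → CongMod V K s u u
  CongMod-refl K s u = (λ _ → 0ℚ) , 0∈ K , λ i →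
    sym (trans (cong (_+_ (u i)) (ℚP.*-zeroʳ (ι (+ s)))) (ℚP.+-identityʳ (u i)))

  Good⇒Represents : ∀ {K L : Lattice V} s {x y} (A b a : ℤ) → _∈_ V y K → Good V x K L s y →
                    Q V x ≡ ι A → B V x y ≡ ι b → Q V y ≡ ι a → Represents V L A b a
  Good⇒Represents {K} s {x} {y} _ _ _ y∈K (τ , ((isometry , _) , _ , τx∈L) , τ[y+sK]⊆L) Qx Bxy Qy =
    app V τ x , app V τ y , τx∈L , τ[y+sK]⊆L y y∈K (CongMod-refl K s y) ,
    trans (isometry x x) Qx , trans (isometry x y) Bxy , trans (isometry y y) Qy

module _ {n} (V : QuadSpace n) (A s : ℕ) (α β : ℤ) where

  Prec⇒Represents : ∀ (K L : Lattice V) → Prec V A α β s K L → (b a : ℤ) → InS A α β s b a →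
                    Represents V K (+ A) b a → Represents V L (+ A) b a
  Prec⇒Represents K L K≺L b a (s∣a-α , s∣b-β , _) (x , y , x∈K , y∈K , Qx , Bxy , Qy) =
    Good⇒Represents V {K} {L} s (+ A) b a y∈K
      (K≺L x x∈K Qx y y∈K (∣⇒≡[modℚ] (+ s) a α s∣a-α Qy)
                         (∣⇒≡[modℚ] (+ s) b β s∣b-β Byx)) Qx Bxy Qy
    where
    Byx : B V y x ≡ ι b
    Byx = trans (bil-sym (QuadSpace.gram V) (QuadSpace.symm V) x y) Bxy

lemma2p2 : ∀ {n} (V : QuadSpace n) (A s : ℕ) → A > 0 → s > 0 → (α β : ℤ)
    → (∀ (K L : Lattice V) → Prec V A α β s K L → (b a : ℤ) → InS A α β s b a
        → Represents V K (+ A) b a → Represents V L (+ A) b a)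
    × (∀ (L : Lattice V) → (∀ (M : Lattice V) → InGenus V M L → Prec V A α β s M L)
        → (b a : ℤ) → InS A α β s b a
        → (∃ λ (M : Lattice V) → InGenus V M L × Represents V M (+ A) b a)
        → Represents V L (+ A) b a)
lemma2p2 V A s _ _ α β =
  Prec⇒Represents V A s α β ,
  λ L gen≺L b a ℓ∈S (M , M∈genL , M→ℓ) →
    Prec⇒Represents V A s α β M L (gen≺L M M∈genL) b a ℓ∈S M→ℓ
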